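{- Let $A_{n,k}$ be the $(n,k)$-arrangement graph with the comparison diagnosis model described in the context. Then $t_c(A_{n,k})\leq (3k-2)(n-k)-3$ for $k\geq 4$, $n\geq k+2$, and $t_c(A_{n,k})\leq 3n-7$ for $k\geq 4$, $n=k+1$.
   Context: For integers $n>k\geq 1$, the $(n,k)$-arrangement graph $A_{n,k}$ has as vertices all arrangements $p_1p_2\cdots p_k$ of $k$ distinct elements of $\{1,\dots,n\}$, two vertices being adjacent iff they differ in exactly one position. Comparison (MM*) model on a graph $G$: for every vertex $w$ and every two distinct neighbours $u,v$ of $w$ there is a comparison $(u,v)_w$; the set of all comparisons is $C$. A syndrome is a map $\sigma:C\to\{0,1\}$. A set $F\subsetneq V(G)$ is compatible with $\sigma$ if for every comparison $(u,v)_w$ with $w\notin F$: $\sigma((u,v)_w)=0$ when $u,v\notin F$ and $\sigma((u,v)_w)=1$ when $u\in F$ or $v\in F$ (comparisons with $w\in F$ may take any value). Two distinct sets $F_1,F_2$ are distinguishable if no syndrome is compatible with both. A set $F$ is a conditional fault-set if $G-F$ has no isolated vertex. $G$ is conditionally $t$-diagnosable if every pair of distinct conditional fault-sets $F_1,F_2$ with $|F_1|,|F_2|\leq t$ is distinguishable; $t_c(G)$ is the maximum such $t$. -}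

module Defs where

open import Data.Nat using (ℕ; _≤_)
open import Data.Fin using (Fin)
open import Data.Vec using (Vec; lookup)
open import Data.Bool using (Bool; true; false)
open import Data.List using (List; length)
open import Data.List.Membership.Propositional using (_∈_; _∉_)
open import Data.List.Relation.Unary.Unique.Propositional using (Unique)
open import Data.Product using (Σ; ∃; _×_; _,_)
open import Data.Sum using (_⊎_)
open import Relation.Binary.PropositionalEquality using (_≡_; _≢_)
open import Relation.Nullary using (¬_)

-- Words of length k over {1..n} (Fin n stands for {1,…,n}).
Word : ℕ → ℕ → Set
Word n k = Vec (Fin n) k

IsArr : ∀ {n k} → Word n k → Set
IsArr {n} {k} p = ∀ (i j : Fin k) → lookup p i ≡ lookup p j → i ≡ j

Adj : ∀ {n k} → Word n k → Word n k → Set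
Adj {n} {k} p q =
  Σ (Fin k) λ i → (lookup p i ≢ lookup q i) × (∀ (j : Fin k) → j ≢ i → lookup p j ≡ lookup q j)

record VSet (n k : ℕ) : Set where
  constructor vset
  field
    elems   : List (Word n k)
    allArr  : ∀ {p} → p ∈ elems → IsArr p
    nodup   : Unique elems

open VSet public

_∈V_ : ∀ {n k} → Word n k → VSet n k → Set
p ∈V F = p ∈ elems F

_∉V_ : ∀ {n k} → Word n k → VSet n k → Set
p ∉V F = ¬ (p ∈V F)

∣_∣V : ∀ {n k} → VSet n k → ℕ
∣ F ∣V = length (elems F)

Proper : ∀ {n k} → VSet n k → Set
Proper {n} {k} F = Σ (Word n k) λ p → IsArr p × p ∉V F

DistinctSets : ∀ {n k} → VSet n k → VSet n k → Set
DistinctSets {n} {k} F₁ F₂ =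
  Σ (Word n k) λ p → (p ∈V F₁ × p ∉V F₂) ⊎ (p ∈V F₂ × p ∉V F₁)

-- A syndrome: value of the comparison (u,v)_w is σ u v w; comparisons are
-- unordered in u,v, so σ is required to be symmetric in its first two arguments.
-- (Values on triples that are not comparisons are irrelevant.)
record Syndrome (n k : ℕ) : Set where
  constructor syndrome
  field
    σ    : Word n k → Word n k → Word n k → Bool
    symm : ∀ u v w → σ u v w ≡ σ v u w

open Syndrome public

IsComparison : ∀ {n k} → Word n k → Word n k → Word n k → Set
IsComparison u v w = IsArr u × IsArr v × IsArr w × Adj u w × Adj v w × u ≢ v

Compatible : ∀ {n k} → VSet n k → Syndrome n k → Set
Compatible {n} {k} F s =
  Proper F ×
  (∀ (u v w : Word n k) → IsComparison u v w → w ∉V F →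
     ((u ∉V F → v ∉V F → σ s u v w ≡ false) ×
      ((u ∈V F ⊎ v ∈V F) → σ s u v w ≡ true)))

Distinguishable : ∀ {n k} → VSet n k → VSet n k → Set
Distinguishable {n} {k} F₁ F₂ = ¬ (Σ (Syndrome n k) λ s → Compatible F₁ s × Compatible F₂ s)

ConditionalFaultSet : ∀ {n k} → VSet n k → Set
ConditionalFaultSet {n} {k} F =
  ∀ (x : Word n k) → IsArr x → x ∉V F →
    Σ (Word n k) λ y → IsArr y × y ∉V F × Adj x y

CondDiagnosable : ℕ → ℕ → ℕ → Set
CondDiagnosable n k t =
  ∀ (F₁ F₂ : VSet n k) → DistinctSets F₁ F₂ →
    ConditionalFaultSet F₁ → ConditionalFaultSet F₂ →
    ∣ F₁ ∣V ≤ t → ∣ F₂ ∣V ≤ t → Distinguishable F₁ F₂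

-- Take a path x – y – z in A_{n,k} whose vertices agree in two positions p, q; let N be the set
-- of vertices off the path adjacent to it, F₁ = N ∪ {x} and F₂ = N ∪ {z}. The syndrome marking a
-- comparison 1 iff a compared vertex lies in N ∪ {x, z} is compatible with both: a healthy tester
-- comparing the other endpoint lies outside Fᵢ next to the path, so it is y, whose other healthy
-- neighbours are again path vertices. Both are conditional fault-sets: the path vertices outside
-- Fᵢ are adjacent to each other, and a vertex off the path reaches a neighbour at distance ≥ 2
-- from the path by writing a fresh symbol at p or q (where it agrees with the path) or else at a
-- third position. Hence t_c ≤ |N|, and |N| is counted for an explicit path.
module Submission where

open import Defs
open import Data.Nat using (ℕ; zero; suc; _≤_; _<_; _+_; _*_; _∸_; z≤n; s≤s; _≤?_)
open import Data.Nat.Properties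
  using (≤-trans; ≰⇒>; <⇒≢; <-irrefl; m≤m+n; m<m+n; m+n∸m≡n; +-assoc; m≤n⇒∃[o]m+o≡n)
open import Data.Nat.Tactic.RingSolver using (solve-∀)
open import Data.Fin using (Fin; zero; suc; toℕ; _↑ˡ_; _↑ʳ_; splitAt) renaming (_≟_ to _≟F_)
open import Data.Fin.Properties
  using (any?; all?; ¬∀⟶∃¬; pigeonhole; ↑ˡ-injective; ↑ʳ-injective; toℕ-↑ˡ; toℕ-↑ʳ; toℕ<n;
         splitAt⁻¹-↑ˡ; splitAt⁻¹-↑ʳ)
open import Data.Vec using (lookup; tabulate; _[_]≔_)
open import Data.Vec.Properties
  using (≡-dec; lookup∘update; lookup∘update′; lookup∘tabulate; tabulate∘lookup; tabulate-cong)
open import Data.Bool.Properties using (∨-comm)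
open import Data.List using (List; []; _∷_; length; filter; deduplicate; cartesianProductWith; _++_; map)
  renaming (tabulate to tabulateL)
open import Data.List.Properties
  using (length-++; length-map; length-tabulate; length-filter; length-deduplicate)
open import Data.List.Membership.Propositional using (_∈_)
open import Data.List.Membership.Propositional.Properties
  using (∈-filter⁺; ∈-filter⁻; ∈-deduplicate⁺; ∈-deduplicate⁻; ∈-cartesianProductWith⁺; ∈-tabulate⁺; ∈-map⁺;
         ∈-++⁺ˡ; ∈-++⁺ʳ)
open import Data.List.Relation.Unary.Any using (here; there)
open import Data.List.Relation.Unary.Unique.DecPropositional.Properties using (deduplicate-!)
open import Data.Product using (∃; _×_; _,_; proj₁; proj₂)
open import Data.Sum using (_⊎_; inj₁; inj₂; [_,_]; swap) renaming (map to map-⊎)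
open import Data.Empty using (⊥-elim)
open import Function using (_∘_)
open import Relation.Nullary using (¬_; Dec; yes; no; does)
open import Relation.Nullary.Decidable using (_×-dec_; _⊎-dec_; _→-dec_; ¬?; map′; dec-true; dec-false)
open import Relation.Binary.PropositionalEquality using (_≡_; _≢_; refl; sym; trans; cong; cong₂; subst)

length-cartesianProductWith : ∀ {A B C : Set} (f : A → B → C) (xs : List A) (ys : List B) →
  length (cartesianProductWith f xs ys) ≡ length xs * length ys
length-cartesianProductWith f []       ys = refl
length-cartesianProductWith f (x ∷ xs) ys =
  trans (length-++ (map (f x) ys)) (cong₂ _+_ (length-map (f x) ys) (length-cartesianProductWith f xs ys))

length-++-≡ : ∀ {A : Set} (xs ys : List A) {l l′ : ℕ} →
  length xs ≡ l → length ys ≡ l′ → length (xs ++ ys) ≡ l + l′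
length-++-≡ xs ys e e′ = trans (length-++ xs) (cong₂ _+_ e e′)

length-map-tabulate : ∀ {A B : Set} {N} (f : A → B) (g : Fin N → A) → length (map f (tabulateL g)) ≡ N
length-map-tabulate f g = trans (length-map f (tabulateL g)) (length-tabulate g)

length-grid : ∀ {A B C : Set} (f : A → B → C) xs ys {l l′ : ℕ} →
  length xs ≡ l → length ys ≡ l′ → length (cartesianProductWith f xs ys) ≡ l * l′
length-grid f xs ys e e′ = trans (length-cartesianProductWith f xs ys) (cong₂ _*_ e e′)

≤-∸-of-+ : ∀ {t l c N : ℕ} → t ≤ l → c + l ≡ N → t ≤ N ∸ c
≤-∸-of-+ {t} {l} {c} t≤l e = subst (t ≤_) (trans (sym (m+n∸m≡n c l)) (cong (_∸ c) e)) t≤l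

module _ {n k : ℕ} where

  _≟W_ : (u v : Word n k) → Dec (u ≡ v)
  _≟W_ = ≡-dec _≟F_

  isArr? : (w : Word n k) → Dec (IsArr w)
  isArr? w = all? λ i → all? λ j → (lookup w i ≟F lookup w j) →-dec (i ≟F j)

  adj? : (u v : Word n k) → Dec (Adj u v)
  adj? u v = any? λ i → ¬? (lookup u i ≟F lookup v i)
                        ×-dec all? (λ j → ¬? (j ≟F i) →-dec (lookup u j ≟F lookup v j))

  Adj-sym : ∀ {u v : Word n k} → Adj u v → Adj v u
  Adj-sym (i , uᵢ≢vᵢ , agree) = i , (λ e → uᵢ≢vᵢ (sym e)) , λ j j≢i → sym (agree j j≢i)

  Adj-irrefl : ∀ {u : Word n k} → ¬ Adj u u
  Adj-irrefl (i , uᵢ≢uᵢ , _) = uᵢ≢uᵢ refl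

  lookup-ext : ∀ {u v : Word n k} → (∀ i → lookup u i ≡ lookup v i) → u ≡ v
  lookup-ext {u} {v} h = trans (sym (tabulate∘lookup u)) (trans (tabulate-cong h) (tabulate∘lookup v))

  Fresh : Word n k → Fin n → Set
  Fresh w s = ∀ i → lookup w i ≢ s

  fresh-exists : k < n → ∀ {w : Word n k} → IsArr w → ∃ (Fresh w)
  fresh-exists k<n {w} arr
    with ¬∀⟶∃¬ n (λ s → ∃ λ i → lookup w i ≡ s) (λ s → any? λ i → lookup w i ≟F s) ¬onto
    where
    ¬onto : ¬ (∀ s → ∃ λ i → lookup w i ≡ s)
    ¬onto onto with pigeonhole k<n (proj₁ ∘ onto)
    ... | s , s′ , s<s′ , e = <⇒≢ s<s′ (cong toℕ (trans (sym (proj₂ (onto s)))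
                                          (trans (cong (lookup w) e) (proj₂ (onto s′)))))
  ... | s , s-missing = s , λ i e → s-missing (i , e)

  IsArr-[]≔ : ∀ {w : Word n k} {s} → IsArr w → Fresh w s → ∀ j → IsArr (w [ j ]≔ s)
  IsArr-[]≔ {w} {s} arr fresh j i i′ e with i ≟F j | i′ ≟F j
  ... | yes refl | yes refl = refl
  ... | yes refl | no i′≢j  =
    ⊥-elim (fresh i′ (sym (trans (sym (lookup∘update i w s)) (trans e (lookup∘update′ i′≢j w s)))))
  ... | no i≢j   | yes refl =
    ⊥-elim (fresh i (trans (sym (lookup∘update′ i≢j w s)) (trans e (lookup∘update i′ w s))))
  ... | no i≢j   | no i′≢j  = arr i i′ (trans (sym (lookup∘update′ i≢j w s)) (trans e (lookup∘update′ i′≢j w s)))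

  Adj-[]≔ : ∀ {w : Word n k} {s} → Fresh w s → ∀ j → Adj w (w [ j ]≔ s)
  Adj-[]≔ {w} {s} fresh j =
    j , (λ e → fresh j (trans e (lookup∘update j w s))) , λ l l≢j → sym (lookup∘update′ l≢j w s)

  Adj⇒[]≔ : ∀ {w a : Word n k} → IsArr w → Adj w a →
            ∃ λ i → Fresh a (lookup w i) × w ≡ a [ i ]≔ lookup w i
  Adj⇒[]≔ {w} {a} arr (i , wᵢ≢aᵢ , agree) = i , fresh , lookup-ext same
    where
    fresh : Fresh a (lookup w i)
    fresh j e with j ≟F i
    ... | yes refl = wᵢ≢aᵢ (sym e)
    ... | no j≢i   = j≢i (arr j i (trans (agree j j≢i) e))
    same : ∀ l → lookup w l ≡ lookup (a [ i ]≔ lookup w i) l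
    same l with l ≟F i
    ... | yes refl = sym (lookup∘update l a (lookup w l))
    ... | no l≢i   = trans (agree l l≢i) (sym (lookup∘update′ l≢i a (lookup w i)))

  Far : Word n k → Word n k → Set
  Far u a = u ≢ a × ¬ Adj u a

  []≔-far-from-agreeing : ∀ {w a : Word n k} {j s} → Fresh w s → lookup w j ≡ lookup a j → w ≢ a →
                           Far (w [ j ]≔ s) a
  []≔-far-from-agreeing {w} {a} {j} {s} fresh wⱼ≡aⱼ w≢a = ≢a , ¬adj
    where
    ≢a : (w [ j ]≔ s) ≢ a
    ≢a e = fresh j (trans wⱼ≡aⱼ (trans (sym (cong (λ v → lookup v j) e)) (lookup∘update j w s)))
    ¬adj : ¬ Adj (w [ j ]≔ s) a
    ¬adj (i , _ , agree) with j ≟F i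
    ... | no j≢i   = fresh j (trans wⱼ≡aⱼ (trans (sym (agree j j≢i)) (lookup∘update j w s)))
    ... | yes refl = w≢a (lookup-ext same)
      where
      same : ∀ l → lookup w l ≡ lookup a l
      same l with l ≟F j
      ... | yes refl = wⱼ≡aⱼ
      ... | no l≢j   = trans (sym (lookup∘update′ l≢j w s)) (agree l l≢j)

  []≔-far-from-twice-differing : ∀ {w a : Word n k} {p q j s} → p ≢ q →
    lookup w p ≢ lookup a p → lookup w q ≢ lookup a q → j ≢ p → j ≢ q → Far (w [ j ]≔ s) a
  []≔-far-from-twice-differing {w} {a} {p} {q} {j} {s} p≢q wₚ≢aₚ w_q≢a_q j≢p j≢q = ≢a , ¬adj
    where
    kept : ∀ {l} → j ≢ l → lookup (w [ j ]≔ s) l ≡ lookup w l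
    kept j≢l = lookup∘update′ (λ e → j≢l (sym e)) w s
    ≢a : (w [ j ]≔ s) ≢ a
    ≢a e = wₚ≢aₚ (trans (sym (kept j≢p)) (cong (λ v → lookup v p) e))
    ¬adj : ¬ Adj (w [ j ]≔ s) a
    ¬adj (i , _ , agree) with p ≟F i
    ... | yes refl = w_q≢a_q (trans (sym (kept j≢q)) (agree q (λ e → p≢q (sym e))))
    ... | no p≢i   = wₚ≢aₚ (trans (sym (kept j≢p)) (agree p p≢i))

module Path {n k : ℕ} (k<n : k < n) (x y z : Word n k)
  (arr-x : IsArr x) (arr-y : IsArr y) (arr-z : IsArr z)
  (x~y : Adj x y) (z~y : Adj z y) (x≢z : x ≢ z)
  {p q r : Fin k} (p≢q : p ≢ q) (r≢p : r ≢ p) (r≢q : r ≢ q)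
  (yₚ : lookup y p ≡ lookup x p) (zₚ : lookup z p ≡ lookup x p)
  (y_q : lookup y q ≡ lookup x q) (z_q : lookup z q ≡ lookup x q)
  where

  Endpoint OnPath NearPath Boundary Flagged : Word n k → Set
  Endpoint w = w ≡ x ⊎ w ≡ z
  OnPath   w = w ≡ y ⊎ Endpoint w
  NearPath w = ∃ λ a → OnPath a × Adj w a
  Boundary w = NearPath w × ¬ OnPath w
  Flagged  w = Boundary w ⊎ Endpoint w

  onPath? : ∀ w → Dec (OnPath w)
  onPath? w = (w ≟W y) ⊎-dec ((w ≟W x) ⊎-dec (w ≟W z))

  nearPath? : ∀ w → Dec (NearPath w)
  nearPath? w = map′ witness classify (adj? w y ⊎-dec (adj? w x ⊎-dec adj? w z))
    where
    witness : Adj w y ⊎ (Adj w x ⊎ Adj w z) → NearPath w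
    witness (inj₁ w~y)        = y , inj₁ refl , w~y
    witness (inj₂ (inj₁ w~x)) = x , inj₂ (inj₁ refl) , w~x
    witness (inj₂ (inj₂ w~z)) = z , inj₂ (inj₂ refl) , w~z
    classify : NearPath w → Adj w y ⊎ (Adj w x ⊎ Adj w z)
    classify (_ , inj₁ refl , w~a)        = inj₁ w~a
    classify (_ , inj₂ (inj₁ refl) , w~a) = inj₂ (inj₁ w~a)
    classify (_ , inj₂ (inj₂ refl) , w~a) = inj₂ (inj₂ w~a)

  boundary? : ∀ w → Dec (Boundary w)
  boundary? w = nearPath? w ×-dec ¬? (onPath? w)

  flagged? : ∀ w → Dec (Flagged w)
  flagged? w = boundary? w ⊎-dec ((w ≟W x) ⊎-dec (w ≟W z))

  endpoint-arr : ∀ {a} → Endpoint a → IsArr a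
  endpoint-arr (inj₁ refl) = arr-x
  endpoint-arr (inj₂ refl) = arr-z

  endpoint-adj : ∀ {a} → Endpoint a → Adj a y
  endpoint-adj (inj₁ refl) = x~y
  endpoint-adj (inj₂ refl) = z~y

  onPath-agrees-at-p : ∀ {a} → OnPath a → lookup a p ≡ lookup x p
  onPath-agrees-at-p (inj₁ refl)        = yₚ
  onPath-agrees-at-p (inj₂ (inj₁ refl)) = refl
  onPath-agrees-at-p (inj₂ (inj₂ refl)) = zₚ

  onPath-agrees-at-q : ∀ {a} → OnPath a → lookup a q ≡ lookup x q
  onPath-agrees-at-q (inj₁ refl)        = y_q
  onPath-agrees-at-q (inj₂ (inj₁ refl)) = refl
  onPath-agrees-at-q (inj₂ (inj₂ refl)) = z_q

  -- Change w at p or q if it agrees there with the path, else at r, to a symbol it lacks.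
  escape : ∀ {w} → IsArr w → ¬ OnPath w →
           ∃ λ w′ → IsArr w′ × Adj w w′ × (∀ {a} → OnPath a → Far w′ a)
  escape {w} arr ¬on with fresh-exists k<n {w = w} arr
  ... | s , fresh with far-position
    where
    ≢onPath : ∀ {a} → OnPath a → w ≢ a
    ≢onPath on refl = ¬on on
    far-position : ∃ λ j → ∀ {a} → OnPath a → Far (w [ j ]≔ s) a
    far-position with lookup w p ≟F lookup x p | lookup w q ≟F lookup x q
    ... | yes wₚ | _       = p , λ on → []≔-far-from-agreeing {w = w} fresh
                                         (trans wₚ (sym (onPath-agrees-at-p on))) (≢onPath on)
    ... | no _   | yes w_q = q , λ on → []≔-far-from-agreeing {w = w} fresh
                                         (trans w_q (sym (onPath-agrees-at-q on))) (≢onPath on)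
    ... | no wₚ  | no w_q  = r , λ on → []≔-far-from-twice-differing {w = w} p≢q
                                         (λ e → wₚ (trans e (onPath-agrees-at-p on)))
                                         (λ e → w_q (trans e (onPath-agrees-at-q on))) r≢p r≢q
  ... | j , far = (w [ j ]≔ s) , IsArr-[]≔ {w = w} arr fresh j , Adj-[]≔ {w = w} fresh j , far

  flaggedSyndrome : Syndrome n k
  flaggedSyndrome = syndrome (λ u v _ → does (flagged? u ⊎-dec flagged? v))
                             (λ u v _ → ∨-comm (does (flagged? u)) (does (flagged? v)))

  CoveredBy : List (Word n k) → Word n k → Set
  CoveredBy G w = OnPath w ⊎ w ∈ G

  SingleChangesCovered : List (Word n k) → Set
  SingleChangesCovered G = ∀ {a} → OnPath a → ∀ i s → Fresh a s → CoveredBy G (a [ i ]≔ s)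

  boundary-∈ : ∀ {G} → SingleChangesCovered G → ∀ {w} → IsArr w → Boundary w → w ∈ G
  boundary-∈ {G} cover {w} arr ((a , on , w~a) , ¬on) with Adj⇒[]≔ {w = w} arr w~a
  ... | i , fresh , w≡ with cover on i (lookup w i) fresh
  ...   | inj₁ on′ = ⊥-elim (¬on (subst OnPath (sym w≡) on′))
  ...   | inj₂ ∈G  = subst (_∈ G) (sym w≡) ∈G

  module FaultSets (G : List (Word n k)) (cover : SingleChangesCovered G) where

    Member : Word n k → Word n k → Set
    Member c w = IsArr w × (Boundary w ⊎ w ≡ c)

    member? : ∀ c w → Dec (Member c w)
    member? c w = isArr? w ×-dec (boundary? w ⊎-dec (w ≟W c))

    candidates members : Word n k → List (Word n k)
    candidates c = filter (member? c) (c ∷ G)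
    members    c = deduplicate _≟W_ (candidates c)

    members⁺ : ∀ {c w} → Member c w → w ∈ members c
    members⁺ {c} {w} m@(arr , b) = ∈-deduplicate⁺ _≟W_ (∈-filter⁺ (member? c) (source b) m)
      where
      source : Boundary w ⊎ w ≡ c → w ∈ c ∷ G
      source (inj₁ b)    = there (boundary-∈ cover arr b)
      source (inj₂ refl) = here refl

    members⁻ : ∀ {c w} → w ∈ members c → Member c w
    members⁻ {c} w∈ = proj₂ (∈-filter⁻ (member? c) {xs = c ∷ G} (∈-deduplicate⁻ _≟W_ (candidates c) w∈))

    faultSet : Word n k → VSet n k
    faultSet c = vset (members c) (proj₁ ∘ members⁻) (deduplicate-! _≟W_ _)

    ∣faultSet∣≤ : ∀ c → ∣ faultSet c ∣V ≤ suc (length G)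
    ∣faultSet∣≤ c = ≤-trans (length-deduplicate _≟W_ (candidates c)) (length-filter (member? c) (c ∷ G))

    module AtEnd (c c′ : Word n k) (c-end : Endpoint c) (c′-end : Endpoint c′) (c≢c′ : c ≢ c′)
                 (ends : ∀ {w} → Endpoint w → w ≡ c ⊎ w ≡ c′) where

      F : VSet n k
      F = faultSet c

      c∈F : c ∈V F
      c∈F = members⁺ (endpoint-arr c-end , inj₂ refl)

      y∉F : y ∉V F
      y∉F y∈ with members⁻ y∈
      ... | _ , inj₁ (_ , ¬on) = ¬on (inj₁ refl)
      ... | _ , inj₂ refl      = Adj-irrefl {u = y} (endpoint-adj c-end)

      c′∉F : c′ ∉V F
      c′∉F c′∈ with members⁻ c′∈
      ... | _ , inj₁ (_ , ¬on) = ¬on (inj₂ c′-end)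
      ... | _ , inj₂ c′≡c      = c≢c′ (sym c′≡c)

      flagged-∈F : ∀ {w} → w ∈V F → Flagged w
      flagged-∈F w∈ with members⁻ w∈
      ... | _ , inj₁ b    = inj₁ b
      ... | _ , inj₂ refl = inj₂ c-end

      near-∉F : ∀ {w} → IsArr w → w ∉V F → NearPath w → w ≡ y ⊎ w ≡ c′
      near-∉F {w} arr w∉ near with onPath? w
      ... | no ¬on         = ⊥-elim (w∉ (members⁺ (arr , inj₁ (near , ¬on))))
      ... | yes (inj₁ w≡y) = inj₁ w≡y
      ... | yes (inj₂ e) with ends e
      ...   | inj₁ w≡c  = ⊥-elim (w∉ (members⁺ (arr , inj₂ w≡c)))
      ...   | inj₂ w≡c′ = inj₂ w≡c′

      -- Outside F only y and c′ are near the path, so a tester w ∉ F comparing c′ is y, and its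
      -- other compared vertex v ∉ F is then c′ again.
      unflagged : ∀ u v w → IsComparison u v w → w ∉V F → u ∉V F → v ∉V F → ¬ Flagged u
      unflagged _ _ _ (arr-u , _ , _ , _ , _ , _) _ u∉ _ (inj₁ b) = u∉ (members⁺ (arr-u , inj₁ b))
      unflagged _ _ w (_ , arr-v , arr-w , u~w , v~w , u≢v) w∉ u∉ v∉ (inj₂ e) with ends e
      ... | inj₁ refl = u∉ c∈F
      ... | inj₂ refl with near-∉F arr-w w∉ (c′ , inj₂ c′-end , Adj-sym {u = c′} {w} u~w)
      ...   | inj₂ refl = Adj-irrefl {u = c′} u~w
      ...   | inj₁ refl with near-∉F arr-v v∉ (y , inj₁ refl , v~w)
      ...     | inj₁ refl = Adj-irrefl {u = y} v~w
      ...     | inj₂ refl = u≢v refl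

      compatible : Compatible F flaggedSyndrome
      compatible = (y , arr-y , y∉F) , λ u v w cmp w∉ →
        (λ u∉ v∉ → dec-false (flagged? u ⊎-dec flagged? v)
                     [ unflagged u v w cmp w∉ u∉ v∉
                     , unflagged v u w (comparison-sym {u} {v} {w} cmp) w∉ v∉ u∉ ]) ,
        (λ u∨v∈ → dec-true (flagged? u ⊎-dec flagged? v) (map-⊎ flagged-∈F flagged-∈F u∨v∈))
        where
        comparison-sym : ∀ {u v w : Word n k} → IsComparison u v w → IsComparison v u w
        comparison-sym (arr-u , arr-v , arr-w , u~w , v~w , u≢v) =
          arr-v , arr-u , arr-w , v~w , u~w , λ e → u≢v (sym e)

      conditional : ConditionalFaultSet F
      conditional w arr w∉ with onPath? w
      ... | yes (inj₁ refl) = c′ , endpoint-arr c′-end , c′∉F , Adj-sym {u = c′} {y} (endpoint-adj c′-end)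
      ... | yes (inj₂ e) with ends e
      ...   | inj₁ refl = ⊥-elim (w∉ c∈F)
      ...   | inj₂ refl = y , arr-y , y∉F , endpoint-adj c′-end
      conditional w arr w∉ | no ¬on with escape {w} arr ¬on
      ... | w′ , arr′ , w~w′ , far = w′ , arr′ , w′∉F , w~w′
        where
        w′∉F : w′ ∉V F
        w′∉F w′∈ with members⁻ w′∈
        ... | _ , inj₁ ((_ , on , w′~a) , _) = proj₂ (far on) w′~a
        ... | _ , inj₂ w′≡c                  = proj₁ (far (inj₂ c-end)) w′≡c

    module FromX = AtEnd x z (inj₁ refl) (inj₂ refl) x≢z (λ e → e)
    module FromZ = AtEnd z x (inj₂ refl) (inj₁ refl) (x≢z ∘ sym) swap

  -- Both fault sets have at most |G| + 1 elements, so t > |G| would have to distinguish them.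
  condDiagnosable⇒≤ : ∀ {G} → SingleChangesCovered G → ∀ t → CondDiagnosable n k t → t ≤ length G
  condDiagnosable⇒≤ {G} cover t diag with t ≤? length G
  ... | yes t≤ = t≤
  ... | no t≰ = ⊥-elim (diag FromX.F FromZ.F (x , inj₁ (FromX.c∈F , FromZ.c′∉F))
                          FromX.conditional FromZ.conditional (small x) (small z)
                          (flaggedSyndrome , FromX.compatible , FromZ.compatible))
    where
    open FaultSets G cover
    small : ∀ c → ∣ faultSet c ∣V ≤ t
    small c = ≤-trans (∣faultSet∣≤ c) (≰⇒> t≰)

-- The concrete path starts at the identity arrangement ι = 0 1 ⋯ (k−1) of A_{k+m,k}; its symbols
-- are the low symbols i ↑ˡ m (i < k) and the high symbols k ↑ʳ j (j < m).
module Identity (a m′ : ℕ) where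

  k m n : ℕ
  k = 4 + a
  m = suc m′
  n = k + m

  low : Fin k → Fin n
  low i = i ↑ˡ m

  high : Fin m → Fin n
  high j = k ↑ʳ j

  data Symbol : Fin n → Set where
    low′  : ∀ i → Symbol (low i)
    high′ : ∀ j → Symbol (high j)

  symbol : ∀ s → Symbol s
  symbol s with splitAt k s in eq
  ... | inj₁ i = subst Symbol (splitAt⁻¹-↑ˡ eq) (low′ i)
  ... | inj₂ j = subst Symbol (splitAt⁻¹-↑ʳ eq) (high′ j)

  low≢high : ∀ i j → low i ≢ high j
  low≢high i j e = <-irrefl refl (≤-trans (subst (_< k) toℕ-eq (toℕ<n i)) (m≤m+n k (toℕ j)))
    where
    toℕ-eq : toℕ i ≡ k + toℕ j
    toℕ-eq = trans (sym (toℕ-↑ˡ i m)) (trans (cong toℕ e) (toℕ-↑ʳ k j))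

  ι y : Word n k
  ι = tabulate low
  y = ι [ zero ]≔ high zero

  lookup-ι : ∀ i → lookup ι i ≡ low i
  lookup-ι = lookup∘tabulate low

  low-∉ι : ∀ i → ¬ Fresh ι (low i)
  low-∉ι i fresh = fresh i (lookup-ι i)

  arr-ι : IsArr ι
  arr-ι i j e = ↑ˡ-injective m i j (trans (sym (lookup-ι i)) (trans e (lookup-ι j)))

  arr-y : IsArr y
  arr-y = IsArr-[]≔ {w = ι} arr-ι (λ i e → low≢high i zero (trans (sym (lookup-ι i)) e)) zero

  ι~y : Adj ι y
  ι~y = zero , (λ ()) , agree
    where
    agree : ∀ j → j ≢ zero → lookup ι j ≡ lookup y j
    agree zero    j≢0 = ⊥-elim (j≢0 refl)
    agree (suc j) _   = refl

  k<n : k < n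
  k<n = m<m+n k (s≤s z≤n)

  positions≥1 positions≥2 : List (Fin k)
  positions≥1 = tabulateL {n = 3 + a} suc
  positions≥2 = tabulateL {n = 2 + a} (λ i → suc (suc i))

  length-positions≥1 : length positions≥1 ≡ 3 + a
  length-positions≥1 = length-tabulate {A = Fin k} suc

  length-positions≥2 : length positions≥2 ≡ 2 + a
  length-positions≥2 = length-tabulate {A = Fin k} (λ i → suc (suc i))

  pos≥1∈ : ∀ i → suc i ∈ positions≥1
  pos≥1∈ = ∈-tabulate⁺

  pos≥2∈ : ∀ i → suc (suc i) ∈ positions≥2
  pos≥2∈ = ∈-tabulate⁺ {f = λ i → suc (suc i)}

-- For n ≥ k + 2 the path is ι – y – z with y = K₀ 1 2 ⋯ and z = K₀ K₁ 2 ⋯ (Kⱼ the high symbols).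
module LongPath (a b : ℕ) where

  open Identity a (suc b) public

  z : Word n k
  z = y [ suc zero ]≔ high (suc zero)

  arr-z : IsArr z
  arr-z = IsArr-[]≔ {w = y} arr-y K₁∉y (suc zero)
    where
    K₁∉y : Fresh y (high (suc zero))
    K₁∉y zero    e with ↑ʳ-injective k zero (suc zero) e
    ... | ()
    K₁∉y (suc i) e = low≢high (suc i) (suc zero) (trans (sym (lookup-ι (suc i))) e)

  z~y : Adj z y
  z~y = suc zero , (λ e → low≢high (suc zero) (suc zero) (sym e)) , agree
    where
    agree : ∀ j → j ≢ suc zero → lookup z j ≡ lookup y j
    agree zero          _   = refl
    agree (suc zero)    j≢1 = ⊥-elim (j≢1 refl)
    agree (suc (suc j)) _   = refl

  ι≢z : ι ≢ z
  ι≢z e with cong (λ v → lookup v zero) e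
  ... | ()

  open Path k<n ι y z arr-ι arr-y arr-z ι~y z~y ι≢z {p = suc (suc zero)} {q = suc (suc (suc zero))}
    {r = zero} (λ ()) (λ ()) (λ ()) refl refl refl refl

  highs highs≥1 highs≥2 : List (Fin n)
  highs   = tabulateL high
  highs≥1 = tabulateL {n = suc b} (λ j → high (suc j))
  highs≥2 = tabulateL {n = b} (λ j → high (suc (suc j)))

  y-symbols z-symbols : List (Fin n)
  y-symbols = low zero ∷ highs≥1
  z-symbols = low zero ∷ low (suc zero) ∷ highs≥2

  ι₀-changes ι-changes y₁-changes y-changes z₀-changes z-changes G : List (Word n k)
  ι₀-changes = map (ι [ zero ]≔_) highs≥1
  ι-changes  = cartesianProductWith (_[_]≔_ ι) positions≥1 highs
  y₁-changes = map (y [ suc zero ]≔_) (low zero ∷ highs≥2)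
  y-changes  = cartesianProductWith (_[_]≔_ y) positions≥2 y-symbols
  z₀-changes = map (z [ zero ]≔_) (low (suc zero) ∷ highs≥2)
  z-changes  = cartesianProductWith (_[_]≔_ z) positions≥2 z-symbols
  G = ι₀-changes ++ ι-changes ++ y₁-changes ++ y-changes ++ z₀-changes ++ z-changes

  via-ι₀ : ∀ {w} → w ∈ ι₀-changes → w ∈ G
  via-ι₀ = ∈-++⁺ˡ
  via-ι : ∀ {i s} → i ∈ positions≥1 → s ∈ highs → (ι [ i ]≔ s) ∈ G
  via-ι i∈ s∈ = ∈-++⁺ʳ ι₀-changes (∈-++⁺ˡ (∈-cartesianProductWith⁺ (_[_]≔_ ι) i∈ s∈))
  via-y₁ : ∀ {w} → w ∈ y₁-changes → w ∈ G
  via-y₁ = ∈-++⁺ʳ ι₀-changes ∘ ∈-++⁺ʳ ι-changes ∘ ∈-++⁺ˡ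
  via-y : ∀ {i s} → i ∈ positions≥2 → s ∈ y-symbols → (y [ i ]≔ s) ∈ G
  via-y i∈ s∈ = ∈-++⁺ʳ ι₀-changes (∈-++⁺ʳ ι-changes (∈-++⁺ʳ y₁-changes
                  (∈-++⁺ˡ (∈-cartesianProductWith⁺ (_[_]≔_ y) i∈ s∈))))
  via-z₀ : ∀ {w} → w ∈ z₀-changes → w ∈ G
  via-z₀ = ∈-++⁺ʳ ι₀-changes ∘ ∈-++⁺ʳ ι-changes ∘ ∈-++⁺ʳ y₁-changes ∘ ∈-++⁺ʳ y-changes ∘ ∈-++⁺ˡ
  via-z : ∀ {i s} → i ∈ positions≥2 → s ∈ z-symbols → (z [ i ]≔ s) ∈ G
  via-z i∈ s∈ = ∈-++⁺ʳ ι₀-changes (∈-++⁺ʳ ι-changes (∈-++⁺ʳ y₁-changes (∈-++⁺ʳ y-changes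
                  (∈-++⁺ʳ z₀-changes (∈-cartesianProductWith⁺ (_[_]≔_ z) i∈ s∈)))))

  high∈ : ∀ j → high j ∈ highs
  high∈ = ∈-tabulate⁺
  high≥1∈ : ∀ j → high (suc j) ∈ highs≥1
  high≥1∈ = ∈-tabulate⁺ {f = λ j → high (suc j)}
  high≥2∈ : ∀ j → high (suc (suc j)) ∈ highs≥2
  high≥2∈ = ∈-tabulate⁺ {f = λ j → high (suc (suc j))}

  cover-ι : ∀ i {s} → Symbol s → Fresh ι s → CoveredBy G (ι [ i ]≔ s)
  cover-ι i       (low′ l)        fresh = ⊥-elim (low-∉ι l fresh)
  cover-ι zero    (high′ zero)    _     = inj₁ (inj₁ refl)
  cover-ι zero    (high′ (suc j)) _     = inj₂ (via-ι₀ (∈-map⁺ (ι [ zero ]≔_) (high≥1∈ j)))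
  cover-ι (suc i) (high′ j)       _     = inj₂ (via-ι (pos≥1∈ i) (high∈ j))

  cover-y : ∀ i {s} → Symbol s → Fresh y s → CoveredBy G (y [ i ]≔ s)
  cover-y zero          (low′ zero)           _     = inj₁ (inj₂ (inj₁ refl))
  cover-y (suc zero)    (low′ zero)           _     = inj₂ (via-y₁ (here refl))
  cover-y (suc (suc i)) (low′ zero)           _     = inj₂ (via-y (pos≥2∈ i) (here refl))
  cover-y i             (low′ (suc l))        fresh = ⊥-elim (fresh (suc l) (lookup-ι (suc l)))
  cover-y i             (high′ zero)          fresh = ⊥-elim (fresh zero refl)
  cover-y zero          (high′ (suc j))       _     = inj₂ (via-ι₀ (∈-map⁺ (ι [ zero ]≔_) (high≥1∈ j)))
  cover-y (suc zero)    (high′ (suc zero))    _     = inj₁ (inj₂ (inj₂ refl))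
  cover-y (suc zero)    (high′ (suc (suc j))) _     =
    inj₂ (via-y₁ (there (∈-map⁺ (y [ suc zero ]≔_) (high≥2∈ j))))
  cover-y (suc (suc i)) (high′ (suc j))       _     = inj₂ (via-y (pos≥2∈ i) (there (high≥1∈ j)))

  cover-z : ∀ i {s} → Symbol s → Fresh z s → CoveredBy G (z [ i ]≔ s)
  cover-z zero          (low′ zero)           _     = inj₂ (via-ι (pos≥1∈ zero) (high∈ (suc zero)))
  cover-z (suc zero)    (low′ zero)           _     = inj₂ (via-y₁ (here refl))
  cover-z (suc (suc i)) (low′ zero)           _     = inj₂ (via-z (pos≥2∈ i) (here refl))
  cover-z zero          (low′ (suc zero))     _     = inj₂ (via-z₀ (here refl))
  cover-z (suc zero)    (low′ (suc zero))     _     = inj₁ (inj₁ refl)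
  cover-z (suc (suc i)) (low′ (suc zero))     _     = inj₂ (via-z (pos≥2∈ i) (there (here refl)))
  cover-z i             (low′ (suc (suc l)))  fresh = ⊥-elim (fresh (suc (suc l)) (lookup-ι (suc (suc l))))
  cover-z i             (high′ zero)          fresh = ⊥-elim (fresh zero refl)
  cover-z i             (high′ (suc zero))    fresh = ⊥-elim (fresh (suc zero) refl)
  cover-z zero          (high′ (suc (suc j))) _     =
    inj₂ (via-z₀ (there (∈-map⁺ (z [ zero ]≔_) (high≥2∈ j))))
  cover-z (suc zero)    (high′ (suc (suc j))) _     =
    inj₂ (via-y₁ (there (∈-map⁺ (y [ suc zero ]≔_) (high≥2∈ j))))
  cover-z (suc (suc i)) (high′ (suc (suc j))) _     = inj₂ (via-z (pos≥2∈ i) (there (there (high≥2∈ j))))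

  covered : SingleChangesCovered G
  covered (inj₁ refl)        i s = cover-y i (symbol s)
  covered (inj₂ (inj₁ refl)) i s = cover-ι i (symbol s)
  covered (inj₂ (inj₂ refl)) i s = cover-z i (symbol s)

  length-G : length G ≡
             suc b + ((3 + a) * (2 + b) + (suc b + ((2 + a) * (2 + b) + (suc b + (2 + a) * (2 + b)))))
  length-G =
    length-++-≡ ι₀-changes _ ι₀ (length-++-≡ ι-changes _ ιs (length-++-≡ y₁-changes _ y₁
      (length-++-≡ y-changes _ ys (length-++-≡ z₀-changes z-changes z₀ zs))))
    where
    ι₀ : length ι₀-changes ≡ suc b
    ι₀ = length-map-tabulate (ι [ zero ]≔_) (λ j → high (suc j))
    ιs : length ι-changes ≡ (3 + a) * (2 + b)
    ιs = length-grid (_[_]≔_ ι) positions≥1 highs length-positions≥1 (length-tabulate high)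
    y₁ : length y₁-changes ≡ suc b
    y₁ = cong suc (length-map-tabulate (y [ suc zero ]≔_) (λ j → high (suc (suc j))))
    ys : length y-changes ≡ (2 + a) * (2 + b)
    ys = length-grid (_[_]≔_ y) positions≥2 y-symbols length-positions≥2
           (cong suc (length-tabulate (λ j → high (suc j))))
    z₀ : length z₀-changes ≡ suc b
    z₀ = cong suc (length-map-tabulate (z [ zero ]≔_) (λ j → high (suc (suc j))))
    zs : length z-changes ≡ (2 + a) * (2 + b)
    zs = length-grid (_[_]≔_ z) positions≥2 z-symbols length-positions≥2
           (cong (2 +_) (length-tabulate (λ j → high (suc (suc j)))))

  bound : ∀ t → CondDiagnosable n k t → t ≤ (3 * k ∸ 2) * (2 + b) ∸ 3
  bound t diag = ≤-∸-of-+ {c = 3} (subst (t ≤_) length-G (condDiagnosable⇒≤ covered t diag)) (count a b)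
    where
    -- The right-hand side is 3 * (4 + a) ∸ 2 unfolded, so that the solver sees no subtraction.
    count : ∀ a b →
      3 + (suc b + ((3 + a) * (2 + b) + (suc b + ((2 + a) * (2 + b) + (suc b + (2 + a) * (2 + b))))))
        ≡ (2 + (a + ((4 + a) + ((4 + a) + 0)))) * (2 + b)
    count = solve-∀

-- For n = k + 1 there is a single high symbol K₀; the path is ι – y – z with y = K₀ 1 2 ⋯ and
-- z = K₀ 0 2 ⋯.
module ShortPath (a : ℕ) where

  open Identity a zero public

  z : Word n k
  z = y [ suc zero ]≔ low zero

  arr-z : IsArr z
  arr-z = IsArr-[]≔ {w = y} arr-y 0∉y (suc zero)
    where
    0∉y : Fresh y (low zero)
    0∉y zero    e = low≢high zero zero (sym e)
    0∉y (suc i) e with trans (sym (lookup-ι (suc i))) e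
    ... | ()

  z~y : Adj z y
  z~y = suc zero , (λ ()) , agree
    where
    agree : ∀ j → j ≢ suc zero → lookup z j ≡ lookup y j
    agree zero          _   = refl
    agree (suc zero)    j≢1 = ⊥-elim (j≢1 refl)
    agree (suc (suc j)) _   = refl

  ι≢z : ι ≢ z
  ι≢z e with cong (λ v → lookup v zero) e
  ... | ()

  open Path k<n ι y z arr-ι arr-y arr-z ι~y z~y ι≢z {p = suc (suc zero)} {q = suc (suc (suc zero))}
    {r = zero} (λ ()) (λ ()) (λ ()) refl refl refl refl

  ι-changes y-changes z-changes G : List (Word n k)
  ι-changes = map (λ i → ι [ i ]≔ high zero) positions≥1
  y-changes = map (λ i → y [ i ]≔ low zero) positions≥2
  z-changes = map (λ i → z [ i ]≔ low (suc zero)) positions≥2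
  G = ι-changes ++ y-changes ++ (z [ zero ]≔ low (suc zero)) ∷ z-changes

  cover-ι : ∀ i {s} → Symbol s → Fresh ι s → CoveredBy G (ι [ i ]≔ s)
  cover-ι i       (low′ l)     fresh = ⊥-elim (low-∉ι l fresh)
  cover-ι zero    (high′ zero) _     = inj₁ (inj₁ refl)
  cover-ι (suc i) (high′ zero) _     = inj₂ (∈-++⁺ˡ (∈-map⁺ (λ i → ι [ i ]≔ high zero) (pos≥1∈ i)))

  cover-y : ∀ i {s} → Symbol s → Fresh y s → CoveredBy G (y [ i ]≔ s)
  cover-y zero          (low′ zero)    _     = inj₁ (inj₂ (inj₁ refl))
  cover-y (suc zero)    (low′ zero)    _     = inj₁ (inj₂ (inj₂ refl))
  cover-y (suc (suc i)) (low′ zero)    _     =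
    inj₂ (∈-++⁺ʳ ι-changes (∈-++⁺ˡ (∈-map⁺ (λ i → y [ i ]≔ low zero) (pos≥2∈ i))))
  cover-y i             (low′ (suc l)) fresh = ⊥-elim (fresh (suc l) (lookup-ι (suc l)))
  cover-y i             (high′ zero)   fresh = ⊥-elim (fresh zero refl)

  cover-z : ∀ i {s} → Symbol s → Fresh z s → CoveredBy G (z [ i ]≔ s)
  cover-z i             (low′ zero)          fresh = ⊥-elim (fresh (suc zero) refl)
  cover-z zero          (low′ (suc zero))    _     = inj₂ (∈-++⁺ʳ ι-changes (∈-++⁺ʳ y-changes (here refl)))
  cover-z (suc zero)    (low′ (suc zero))    _     = inj₁ (inj₁ refl)
  cover-z (suc (suc i)) (low′ (suc zero))    _     =
    inj₂ (∈-++⁺ʳ ι-changes (∈-++⁺ʳ y-changes (there (∈-map⁺ (λ i → z [ i ]≔ low (suc zero)) (pos≥2∈ i)))))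
  cover-z i             (low′ (suc (suc l))) fresh = ⊥-elim (fresh (suc (suc l)) (lookup-ι (suc (suc l))))
  cover-z i             (high′ zero)         fresh = ⊥-elim (fresh zero refl)

  covered : SingleChangesCovered G
  covered (inj₁ refl)        i s = cover-y i (symbol s)
  covered (inj₂ (inj₁ refl)) i s = cover-ι i (symbol s)
  covered (inj₂ (inj₂ refl)) i s = cover-z i (symbol s)

  length-G : length G ≡ (3 + a) + ((2 + a) + suc (2 + a))
  length-G = length-++-≡ ι-changes _ (trans (length-map _ positions≥1) length-positions≥1)
               (length-++-≡ y-changes _ (trans (length-map _ positions≥2) length-positions≥2)
                 (cong suc (trans (length-map _ positions≥2) length-positions≥2)))

  bound : ∀ t → CondDiagnosable n k t → t ≤ 3 * n ∸ 7
  bound t diag = ≤-∸-of-+ {c = 7} (subst (t ≤_) length-G (condDiagnosable⇒≤ covered t diag)) (count a)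
    where
    count : ∀ a → 7 + ((3 + a) + ((2 + a) + suc (2 + a))) ≡ 3 * ((4 + a) + 1)
    count = solve-∀

theorem4p2 : ∀ (n k : ℕ) → 4 ≤ k →
    ((k + 2 ≤ n → ∀ (t : ℕ) → CondDiagnosable n k t → t ≤ (3 * k ∸ 2) * (n ∸ k) ∸ 3) ×
     (n ≡ k + 1 → ∀ (t : ℕ) → CondDiagnosable n k t → t ≤ 3 * n ∸ 7))
theorem4p2 n .(4 + a) (s≤s (s≤s (s≤s (s≤s {n = a} z≤n)))) = long , short
  where
  long : 4 + a + 2 ≤ n → ∀ t → CondDiagnosable n (4 + a) t → t ≤ (3 * (4 + a) ∸ 2) * (n ∸ (4 + a)) ∸ 3
  long k+2≤n with m≤n⇒∃[o]m+o≡n k+2≤n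
  ... | b , k+2+b≡n with trans (sym k+2+b≡n) (+-assoc (4 + a) 2 b)
  ... | refl rewrite m+n∸m≡n (4 + a) (2 + b) = LongPath.bound a b

  short : n ≡ 4 + a + 1 → ∀ t → CondDiagnosable n (4 + a) t → t ≤ 3 * n ∸ 7
  short refl = ShortPath.bound a
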